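{- Let $q$ be a prime power and let $S$ be a set of $q+1$ points in $\mathrm{PG}(2,q)$ of degree $q-2$. Then $u_0(S)\in\{3q-9,3q-8,3q-7,3q-6\}$.
   Context: $\mathrm{PG}(2,q)$ is the projective plane over $\mathbb{F}_q$. For a set $S$ of $q+1$ points, $u_i(S)$ is the number of lines of $\mathrm{PG}(2,q)$ containing exactly $i$ points of $S$, and the degree of $S$ is the largest $i$ with $u_i(S)\neq 0$. -}

module Defs where

open import Level using (0ℓ)
open import Data.Nat using (ℕ; zero; suc; _^_; _<_)
open import Data.Nat.Primality using (Prime)
open import Data.Fin using (Fin)
open import Data.List using (List; []; _∷_; _++_; map; concatMap; filter; length)
open import Data.List.Base using (allFin)
open import Data.Product using (∃; ∃₂; _×_; _,_)
open import Relation.Nullary using (¬_; Dec; yes; no)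
open import Relation.Binary.Definitions using (DecidableEquality)
open import Relation.Binary.PropositionalEquality using (_≡_)
open import Algebra.Structures using (IsCommutativeRing)
open import Function.Bundles using (_↔_; Inverse)
open import Data.List.Relation.Unary.Unique.Propositional using (Unique)

IsPrimePower : ℕ → Set
IsPrimePower q = ∃₂ λ p k → Prime p × q ≡ p ^ suc k

record FiniteField : Set₁ where
  infixl 6 _+_
  infixl 7 _*_
  field
    Carrier : Set
    _≟_ : DecidableEquality Carrier
    _+_ _*_ : Carrier → Carrier → Carrier
    -_ : Carrier → Carrier
    0# 1# : Carrier
    isCommutativeRing : IsCommutativeRing _≡_ _+_ _*_ -_ 0# 1#
    0≢1 : ¬ (0# ≡ 1#)
    inverse : ∀ x → ¬ (x ≡ 0#) → ∃ λ y → x * y ≡ 1#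
    size : ℕ
    enum : Carrier ↔ Fin size

  elements : List Carrier
  elements = map (Inverse.from enum) (allFin size)

module PG2 (F : FiniteField) where
  open FiniteField F

  -- Points of PG(2,q) by normalized homogeneous coordinates:
  -- (1:a:b), (0:1:a), (0:0:1).  Every point has exactly one such representative.
  data Point : Set where
    pt₁ : Carrier → Carrier → Point
    pt₂ : Carrier → Point
    pt₃ : Point

  coords : Point → Carrier × Carrier × Carrier
  coords (pt₁ a b) = 1# , a , b
  coords (pt₂ a)   = 0# , 1# , a
  coords pt₃       = 0# , 0# , 1#

  -- Lines are given by normalized dual coordinates [u0:u1:u2], same shape.
  Line : Set
  Line = Point

  allPoints : List Point
  allPoints = concatMap (λ a → map (pt₁ a) elements) elements
              ++ map pt₂ elements ++ pt₃ ∷ []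

  allLines : List Line
  allLines = allPoints

  form : Carrier × Carrier × Carrier → Carrier × Carrier × Carrier → Carrier
  form (u₀ , u₁ , u₂) (x₀ , x₁ , x₂) = u₀ * x₀ + u₁ * x₁ + u₂ * x₂

  Incident : Line → Point → Set
  Incident ℓ P = form (coords ℓ) (coords P) ≡ 0#

  incident? : (ℓ : Line) (P : Point) → Dec (Incident ℓ P)
  incident? ℓ P = form (coords ℓ) (coords P) ≟ 0#

  -- |ℓ ∩ S| for a set S of points given as a duplicate-free list
  meet : List Point → Line → ℕ
  meet S ℓ = length (filter (incident? ℓ) S)

  u : ℕ → List Point → ℕ
  u i S = length (filter (λ ℓ → Data.Nat._≟_ (meet S ℓ) i) allLines)

  HasDegree : List Point → ℕ → Set
  HasDegree S d = ¬ (u d S ≡ 0) × (∀ i → d < i → u i S ≡ 0)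

{-# OPTIONS --safe #-}
module Submission where

-- Let ℓ be a line meeting S in q − 2 points, so that exactly three points A, B, C of S lie off ℓ and
-- exactly three points of ℓ lie outside S.  A line missing S meets ℓ in one of those three points Y,
-- so u₀ is the sum over them of the number of lines through Y missing S.  Apart from ℓ, the lines
-- through Y meet S only in A, B, C, and by inclusion–exclusion those missing all three number
-- q − 3 + [Y ∈ AB] + [Y ∈ AC] + [Y ∈ BC] − [A, B, C, Y collinear].  Each of the lines AB, AC, BC
-- passes through at most one point of ℓ, so summing over the three points Y gives u₀ = 3q − 9 + e
-- with 0 ≤ e ≤ 3.

open import Algebra.Bundles using (CommutativeRing)
open import Data.Empty using (⊥-elim)
open import Data.List using (List; []; _∷_; _++_; map; concatMap; filter; length)
open import Data.List.Membership.Propositional using (_∈_; _∉_)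
open import Data.List.Relation.Unary.Any using (here; there)
open import Data.List.Relation.Unary.Unique.Propositional using (Unique)
import Data.List.Relation.Unary.All as All
open import Data.Nat as ℕ using (ℕ; zero; suc)
import Data.Nat.Properties as ℕ
open import Data.Product using (_×_; _,_; ∃; ∃₂; proj₁; proj₂)
open import Function using (_∘_)
open import Relation.Binary.Definitions using (DecidableEquality)
open import Relation.Binary.PropositionalEquality as ≡ using (_≡_; _≢_)
open import Relation.Nullary using (Dec; yes; no; ¬_; ¬?)
open import Relation.Nullary.Decidable using (_×-dec_)
open import Relation.Unary using (Decidable)

open import Defs

-- The ring solver normalises coefficients, so their equality must compute: we use ℤ, which maps
-- into every commutative ring.
module IntegerCoefficientSolver {c ℓ} (R : CommutativeRing c ℓ) where
  open CommutativeRing R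
  open import Algebra.Solver.Ring.AlmostCommutativeRing using (_-Raw-AlmostCommutative⟶_; fromCommutativeRing)
  open import Data.Integer as ℤ using (ℤ; +_; -[1+_]; _⊖_)
  import Data.Integer.Properties as ℤ
  import Data.Maybe as Maybe
  open import Relation.Nullary.Decidable using (dec⇒maybe)
  open import Algebra.Properties.Ring ring using (-‿distribˡ-*; -‿distribʳ-*)
  open import Algebra.Properties.AbelianGroup +-abelianGroup
    using (ε⁻¹≈ε; ⁻¹-involutive; ⁻¹-∙-comm; xyx⁻¹≈y)
  open import Algebra.Properties.Semiring.Mult.TCOptimised semiring
    using (1+×; ×-homo-+; ×1-homo-*) renaming (_×_ to _×ₙ_)
  open import Relation.Binary.Reasoning.Setoid setoid

  fromℤ : ℤ → Carrier
  fromℤ (+ n)    = n ×ₙ 1#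
  fromℤ -[1+ n ] = - (suc n ×ₙ 1#)

  fromℤ-neg : ∀ i → fromℤ (ℤ.- i) ≈ - fromℤ i
  fromℤ-neg (+ zero)  = sym ε⁻¹≈ε
  fromℤ-neg (+ suc n) = refl
  fromℤ-neg -[1+ n ]  = sym (⁻¹-involutive _)

  fromℤ-⊖ : ∀ m n → fromℤ (m ⊖ n) ≈ m ×ₙ 1# - n ×ₙ 1#
  fromℤ-⊖ zero    zero    = sym (-‿inverseʳ 0#)
  fromℤ-⊖ zero    (suc n) = sym (+-identityˡ _)
  fromℤ-⊖ (suc m) zero    = sym (trans (+-congˡ ε⁻¹≈ε) (+-identityʳ _))
  fromℤ-⊖ (suc m) (suc n) = begin
    fromℤ (suc m ⊖ suc n)              ≡⟨ ≡.cong fromℤ (ℤ.[1+m]⊖[1+n]≡m⊖n m n) ⟩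
    fromℤ (m ⊖ n)                      ≈⟨ fromℤ-⊖ m n ⟩
    m ×ₙ 1# - n ×ₙ 1#                  ≈⟨ +-congʳ (xyx⁻¹≈y 1# (m ×ₙ 1#)) ⟨
    (1# + m ×ₙ 1# + - 1#) - n ×ₙ 1#    ≈⟨ +-assoc _ _ _ ⟩
    (1# + m ×ₙ 1#) + (- 1# - n ×ₙ 1#)  ≈⟨ +-congˡ (⁻¹-∙-comm 1# (n ×ₙ 1#)) ⟩
    (1# + m ×ₙ 1#) - (1# + n ×ₙ 1#)    ≈⟨ +-cong (1+× m 1#) (-‿cong (1+× n 1#)) ⟨
    suc m ×ₙ 1# - suc n ×ₙ 1#          ∎

  fromℤ-+ : ∀ i j → fromℤ (i ℤ.+ j) ≈ fromℤ i + fromℤ j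
  fromℤ-+ (+ m)    (+ n)    = ×-homo-+ 1# m n
  fromℤ-+ (+ m)    -[1+ n ] = fromℤ-⊖ m (suc n)
  fromℤ-+ -[1+ m ] (+ n)    = trans (fromℤ-⊖ n (suc m)) (+-comm _ _)
  fromℤ-+ -[1+ m ] -[1+ n ] = begin
    - (suc (suc (m ℕ.+ n)) ×ₙ 1#)      ≡⟨ ≡.cong (λ k → - (suc k ×ₙ 1#)) (ℕ.+-suc m n) ⟨
    - ((suc m ℕ.+ suc n) ×ₙ 1#)        ≈⟨ -‿cong (×-homo-+ 1# (suc m) (suc n)) ⟩
    - (suc m ×ₙ 1# + suc n ×ₙ 1#)      ≈⟨ ⁻¹-∙-comm _ _ ⟨
    - (suc m ×ₙ 1#) + - (suc n ×ₙ 1#)  ∎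

  fromℤ-*-+ : ∀ m j → fromℤ (+ m ℤ.* j) ≈ fromℤ (+ m) * fromℤ j
  fromℤ-*-+ m (+ n) = begin
    fromℤ (+ m ℤ.* + n)  ≡⟨ ≡.cong fromℤ (ℤ.pos-* m n) ⟨
    (m ℕ.* n) ×ₙ 1#      ≈⟨ ×1-homo-* m n ⟩
    m ×ₙ 1# * (n ×ₙ 1#)  ∎
  fromℤ-*-+ m -[1+ n ] = begin
    fromℤ (+ m ℤ.* ℤ.- + suc n)        ≡⟨ ≡.cong fromℤ (ℤ.neg-distribʳ-* (+ m) (+ suc n)) ⟨
    fromℤ (ℤ.- (+ m ℤ.* + suc n))      ≈⟨ fromℤ-neg (+ m ℤ.* + suc n) ⟩
    - fromℤ (+ m ℤ.* + suc n)          ≈⟨ -‿cong (fromℤ-*-+ m (+ suc n)) ⟩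
    - (fromℤ (+ m) * fromℤ (+ suc n))  ≈⟨ -‿distribʳ-* _ _ ⟩
    fromℤ (+ m) * - fromℤ (+ suc n)    ∎

  fromℤ-* : ∀ i j → fromℤ (i ℤ.* j) ≈ fromℤ i * fromℤ j
  fromℤ-* (+ m)    j = fromℤ-*-+ m j
  fromℤ-* -[1+ m ] j = begin
    fromℤ (ℤ.- (+ suc m) ℤ.* j)    ≡⟨ ≡.cong fromℤ (ℤ.neg-distribˡ-* (+ suc m) j) ⟨
    fromℤ (ℤ.- (+ suc m ℤ.* j))    ≈⟨ fromℤ-neg (+ suc m ℤ.* j) ⟩
    - fromℤ (+ suc m ℤ.* j)        ≈⟨ -‿cong (fromℤ-*-+ (suc m) j) ⟩
    - (fromℤ (+ suc m) * fromℤ j)  ≈⟨ -‿distribˡ-* _ _ ⟩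
    - fromℤ (+ suc m) * fromℤ j    ∎

  fromℤ-homomorphism : ℤ.+-*-rawRing -Raw-AlmostCommutative⟶ fromCommutativeRing R
  fromℤ-homomorphism = record
    { ⟦_⟧ = fromℤ ; +-homo = fromℤ-+ ; *-homo = fromℤ-* ; -‿homo = fromℤ-neg
    ; 0-homo = refl ; 1-homo = refl
    }

  open import Algebra.Solver.Ring ℤ.+-*-rawRing (fromCommutativeRing R) fromℤ-homomorphism
    (λ i j → Maybe.map (reflexive ∘ ≡.cong fromℤ) (dec⇒maybe (i ℤ.≟ j))) public

module Counting where
  open import Algebra.Properties.CommutativeSemigroup ℕ.+-commutativeSemigroup using (interchange)
  open import Data.List.Relation.Unary.AllPairs using (_∷_; [])
  open import Data.Nat using (_+_; _*_; _≤_; z≤n)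
  open import Data.Nat.Properties
    using (≤-refl; ≤-antisym; +-mono-≤; +-assoc; +-suc; +-identityʳ;
           *-comm; *-zeroʳ; *-identityˡ; *-distribˡ-+; *-distribʳ-+)

  χ : ∀ {p} {P : Set p} → Dec P → ℕ
  χ (yes _) = 1
  χ (no _)  = 0

  χ-yes : ∀ {p} {P : Set p} (P? : Dec P) → P → χ P? ≡ 1
  χ-yes (yes _) _  = ≡.refl
  χ-yes (no ¬p) p  = ⊥-elim (¬p p)

  χ-no : ∀ {p} {P : Set p} (P? : Dec P) → ¬ P → χ P? ≡ 0
  χ-no (yes p) ¬p = ⊥-elim (¬p p)
  χ-no (no _)  _  = ≡.refl

  χ≤1 : ∀ {p} {P : Set p} (P? : Dec P) → χ P? ≤ 1
  χ≤1 (yes _) = ≤-refl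
  χ≤1 (no _)  = z≤n

  χ-mono : ∀ {p q} {P : Set p} {Q : Set q} (P? : Dec P) (Q? : Dec Q) → (P → Q) → χ P? ≤ χ Q?
  χ-mono (yes p) (yes _) _   = ≤-refl
  χ-mono (yes p) (no ¬q) p⇒q = ⊥-elim (¬q (p⇒q p))
  χ-mono (no _)  _       _   = z≤n

  χ-cong : ∀ {p q} {P : Set p} {Q : Set q} (P? : Dec P) (Q? : Dec Q) → (P → Q) → (Q → P) → χ P? ≡ χ Q?
  χ-cong P? Q? p⇒q q⇒p = ≤-antisym (χ-mono P? Q? p⇒q) (χ-mono Q? P? q⇒p)

  inclusion-exclusion₃ : ∀ {p q r n} {P : Set p} {Q : Set q} {R : Set r} {N : Set n}
    (P? : Dec P) (Q? : Dec Q) (R? : Dec R) (N? : Dec N) →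
    (N → ¬ P × ¬ Q × ¬ R) → (¬ P × ¬ Q × ¬ R → N) →
    χ N? + (χ P? + (χ Q? + (χ R? + χ P? * (χ Q? * χ R?))))
      ≡ 1 + (χ P? * χ Q? + (χ P? * χ R? + χ Q? * χ R?))
  inclusion-exclusion₃ {P = P} {Q} {R} P? Q? R? N? N⇒none none⇒N =
    ≡.trans (≡.cong (_+ _) (χ-cong N? (¬? P? ×-dec ¬? Q? ×-dec ¬? R?) N⇒none none⇒N)) (by-cases P? Q? R?)
    where
    by-cases : (P? : Dec P) (Q? : Dec Q) (R? : Dec R) →
      χ (¬? P? ×-dec ¬? Q? ×-dec ¬? R?) + (χ P? + (χ Q? + (χ R? + χ P? * (χ Q? * χ R?))))
        ≡ 1 + (χ P? * χ Q? + (χ P? * χ R? + χ Q? * χ R?))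
    by-cases (yes _) (yes _) (yes _) = ≡.refl
    by-cases (yes _) (yes _) (no _)  = ≡.refl
    by-cases (yes _) (no _)  (yes _) = ≡.refl
    by-cases (yes _) (no _)  (no _)  = ≡.refl
    by-cases (no _)  (yes _) (yes _) = ≡.refl
    by-cases (no _)  (yes _) (no _)  = ≡.refl
    by-cases (no _)  (no _)  (yes _) = ≡.refl
    by-cases (no _)  (no _)  (no _)  = ≡.refl

  module _ {a} {A : Set a} where

    ∑ : List A → (A → ℕ) → ℕ
    ∑ []       f = 0
    ∑ (x ∷ xs) f = f x + ∑ xs f

    syntax ∑ xs (λ x → e) = ∑[ x ∈ xs ] e

    ∑-cong-∈ : ∀ xs {f g : A → ℕ} → (∀ {x} → x ∈ xs → f x ≡ g x) → ∑ xs f ≡ ∑ xs g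
    ∑-cong-∈ []       f≗g = ≡.refl
    ∑-cong-∈ (x ∷ xs) f≗g = ≡.cong₂ _+_ (f≗g (here ≡.refl)) (∑-cong-∈ xs (f≗g ∘ there))

    ∑-cong : ∀ xs {f g : A → ℕ} → (∀ x → f x ≡ g x) → ∑ xs f ≡ ∑ xs g
    ∑-cong xs f≗g = ∑-cong-∈ xs (λ {x} _ → f≗g x)

    ∑-mono : ∀ xs {f g : A → ℕ} → (∀ x → f x ≤ g x) → ∑ xs f ≤ ∑ xs g
    ∑-mono []       f≤g = z≤n
    ∑-mono (x ∷ xs) f≤g = +-mono-≤ (f≤g x) (∑-mono xs f≤g)

    ∑-+ : ∀ xs (f g : A → ℕ) → ∑[ x ∈ xs ] (f x + g x) ≡ ∑ xs f + ∑ xs g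
    ∑-+ []       f g = ≡.refl
    ∑-+ (x ∷ xs) f g = ≡.trans (≡.cong (f x + g x +_) (∑-+ xs f g)) (interchange (f x) (g x) _ _)

    ∑-+-nested : ∀ xs (f g : A → ℕ) {G} → ∑ xs g ≡ G → ∑[ x ∈ xs ] (f x + g x) ≡ ∑ xs f + G
    ∑-+-nested xs f g ∑g≡G = ≡.trans (∑-+ xs f g) (≡.cong (∑ xs f +_) ∑g≡G)

    ∑-*ˡ : ∀ xs k (f : A → ℕ) → ∑[ x ∈ xs ] (k * f x) ≡ k * ∑ xs f
    ∑-*ˡ []       k f = ≡.sym (*-zeroʳ k)
    ∑-*ˡ (x ∷ xs) k f = ≡.trans (≡.cong (k * f x +_) (∑-*ˡ xs k f)) (≡.sym (*-distribˡ-+ k (f x) _))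

    ∑-*ʳ : ∀ xs (f : A → ℕ) k → ∑[ x ∈ xs ] (f x * k) ≡ ∑ xs f * k
    ∑-*ʳ xs f k = ≡.trans (∑-cong xs (λ x → *-comm (f x) k)) (≡.trans (∑-*ˡ xs k f) (*-comm k _))

    ∑-const : ∀ xs k → ∑[ _ ∈ xs ] k ≡ length xs * k
    ∑-const []       k = ≡.refl
    ∑-const (x ∷ xs) k = ≡.cong (k +_) (∑-const xs k)

    ∑-++ : ∀ xs ys (f : A → ℕ) → ∑ (xs ++ ys) f ≡ ∑ xs f + ∑ ys f
    ∑-++ []       ys f = ≡.refl
    ∑-++ (x ∷ xs) ys f = ≡.trans (≡.cong (f x +_) (∑-++ xs ys f)) (≡.sym (+-assoc (f x) _ _))

    length-filter-∑ : ∀ {p} {P : A → Set p} (P? : Decidable P) xs → length (filter P? xs) ≡ ∑[ x ∈ xs ] χ (P? x)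
    length-filter-∑ P? []       = ≡.refl
    length-filter-∑ P? (x ∷ xs) with P? x
    ... | yes _ = ≡.cong suc (length-filter-∑ P? xs)
    ... | no _  = length-filter-∑ P? xs

    length-filter-∁ : ∀ {p} {P : A → Set p} (P? : Decidable P) xs →
                      length (filter P? xs) + length (filter (¬? ∘ P?) xs) ≡ length xs
    length-filter-∁ P? []       = ≡.refl
    length-filter-∁ P? (x ∷ xs) with P? x
    ... | yes _ = ≡.cong suc (length-filter-∁ P? xs)
    ... | no _  = ≡.trans (+-suc _ _) (≡.cong suc (length-filter-∁ P? xs))

    ∑-filter : ∀ {p} {P : A → Set p} (P? : Decidable P) xs (f : A → ℕ) →
               ∑ (filter P? xs) f ≡ ∑[ x ∈ xs ] (χ (P? x) * f x)
    ∑-filter P? []       f = ≡.refl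
    ∑-filter P? (x ∷ xs) f with P? x
    ... | yes _ = ≡.cong₂ _+_ (≡.sym (+-identityʳ (f x))) (∑-filter P? xs f)
    ... | no _  = ∑-filter P? xs f

    filter-nonempty : ∀ {p} {P : A → Set p} (P? : Decidable P) xs → length (filter P? xs) ≢ 0 → ∃ P
    filter-nonempty P? []       nonempty = ⊥-elim (nonempty ≡.refl)
    filter-nonempty P? (x ∷ xs) nonempty with P? x
    ... | yes px = x , px
    ... | no _   = filter-nonempty P? xs nonempty

  module _ {a b} {A : Set a} {B : Set b} where

    ∑-map : ∀ (h : A → B) xs (f : B → ℕ) → ∑ (map h xs) f ≡ ∑[ x ∈ xs ] f (h x)
    ∑-map h []       f = ≡.refl
    ∑-map h (x ∷ xs) f = ≡.cong (f (h x) +_) (∑-map h xs f)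

    ∑-concatMap : ∀ (h : A → List B) xs (f : B → ℕ) → ∑ (concatMap h xs) f ≡ ∑[ x ∈ xs ] ∑ (h x) f
    ∑-concatMap h []       f = ≡.refl
    ∑-concatMap h (x ∷ xs) f = ≡.trans (∑-++ (h x) (concatMap h xs) f) (≡.cong (∑ (h x) f +_) (∑-concatMap h xs f))

    ∑-comm : ∀ xs ys (f : A → B → ℕ) → ∑[ x ∈ xs ] ∑[ y ∈ ys ] f x y ≡ ∑[ y ∈ ys ] ∑[ x ∈ xs ] f x y
    ∑-comm []       ys f = ≡.sym (≡.trans (∑-const ys 0) (*-zeroʳ (length ys)))
    ∑-comm (x ∷ xs) ys f = ≡.trans (≡.cong (∑ ys (f x) +_) (∑-comm xs ys f)) (≡.sym (∑-+ ys (f x) _))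

  module _ {a} {A : Set a} (_≟_ : DecidableEquality A) where
    open import Data.List.Membership.DecPropositional _≟_ using (_∈?_)

    Enumerates : List A → Set a
    Enumerates xs = ∀ c → ∑[ x ∈ xs ] χ (x ≟ c) ≡ 1

    count-∉ : ∀ {c} xs → c ∉ xs → ∑[ x ∈ xs ] χ (x ≟ c) ≡ 0
    count-∉     []       c∉ = ≡.refl
    count-∉ {c} (x ∷ xs) c∉ with x ≟ c
    ... | yes ≡.refl = ⊥-elim (c∉ (here ≡.refl))
    ... | no _       = count-∉ xs (c∉ ∘ there)

    count-unique : ∀ {c xs} → Unique xs → c ∈ xs → ∑[ x ∈ xs ] χ (x ≟ c) ≡ 1
    count-unique {c} {x ∷ xs} (x∉xs ∷ xs!) c∈ with x ≟ c | c∈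
    ... | yes ≡.refl | _           = ≡.cong suc (count-∉ xs (λ x∈xs → All.lookup x∉xs x∈xs ≡.refl))
    ... | no x≢c     | here c≡x    = ⊥-elim (x≢c (≡.sym c≡x))
    ... | no _       | there c∈xs  = count-unique xs! c∈xs

    unique⇒enumerates : ∀ {xs} → Unique xs → (∀ c → c ∈ xs) → Enumerates xs
    unique⇒enumerates xs! complete c = count-unique xs! (complete c)

    enumerates⇒∈ : ∀ xs → Enumerates xs → ∀ c → c ∈ xs
    enumerates⇒∈ xs enum c = count≢0⇒∈ xs (λ count≡0 → 1≢0 (≡.trans (≡.sym (enum c)) count≡0))
      where
      1≢0 : 1 ≢ 0
      1≢0 ()
      count≢0⇒∈ : ∀ xs → ∑[ x ∈ xs ] χ (x ≟ c) ≢ 0 → c ∈ xs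
      count≢0⇒∈ []       count≢0 = ⊥-elim (count≢0 ≡.refl)
      count≢0⇒∈ (x ∷ xs) count≢0 with x ≟ c
      ... | yes ≡.refl = here ≡.refl
      ... | no _       = there (count≢0⇒∈ xs count≢0)

    ∑-pick : ∀ xs → Enumerates xs → ∀ c (g : A → ℕ) → ∑[ x ∈ xs ] (χ (x ≟ c) * g x) ≡ g c
    ∑-pick xs enum c g = begin
      ∑[ x ∈ xs ] (χ (x ≟ c) * g x)  ≡⟨ ∑-cong xs only-c ⟩
      ∑[ x ∈ xs ] (χ (x ≟ c) * g c)  ≡⟨ ∑-*ʳ xs (λ x → χ (x ≟ c)) (g c) ⟩
      ∑[ x ∈ xs ] χ (x ≟ c) * g c    ≡⟨ ≡.cong (_* g c) (enum c) ⟩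
      1 * g c                        ≡⟨ *-identityˡ (g c) ⟩
      g c                            ∎
      where
      open ≡.≡-Reasoning
      only-c : ∀ x → χ (x ≟ c) * g x ≡ χ (x ≟ c) * g c
      only-c x with x ≟ c
      ... | yes ≡.refl = ≡.refl
      ... | no _       = ≡.refl

    ∑-restrict : ∀ U → Enumerates U → ∀ {S} → Unique S → (f : A → ℕ) →
                 ∑[ x ∈ U ] (χ (x ∈? S) * f x) ≡ ∑ S f
    ∑-restrict U enum {[]}    []           f = ≡.trans (∑-const U 0) (*-zeroʳ (length U))
    ∑-restrict U enum {s ∷ S} (s∉S ∷ S!)   f = begin
      ∑[ x ∈ U ] (χ (x ∈? s ∷ S) * f x)                            ≡⟨ ∑-cong U split ⟩
      ∑[ x ∈ U ] (χ (x ≟ s) * f x + χ (x ∈? S) * f x)              ≡⟨ ∑-+ U _ _ ⟩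
      ∑[ x ∈ U ] (χ (x ≟ s) * f x) + ∑[ x ∈ U ] (χ (x ∈? S) * f x)
        ≡⟨ ≡.cong₂ _+_ (∑-pick U enum s f) (∑-restrict U enum S! f) ⟩
      f s + ∑ S f                                                  ∎
      where
      open ≡.≡-Reasoning
      χ-∈-∷ : ∀ {x} (x≟s : Dec (x ≡ s)) → χ (x ∈? s ∷ S) ≡ χ x≟s + χ (x ∈? S)
      χ-∈-∷ {x} (yes ≡.refl) = ≡.trans (χ-yes (x ∈? x ∷ S) (here ≡.refl))
                                       (≡.cong suc (≡.sym (χ-no (x ∈? S) (λ x∈S → All.lookup s∉S x∈S ≡.refl))))
      χ-∈-∷ {x} (no x≢s)     =
        χ-cong (x ∈? s ∷ S) (x ∈? S) (λ { (here x≡s) → ⊥-elim (x≢s x≡s) ; (there x∈S) → x∈S }) there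
      split : ∀ x → χ (x ∈? s ∷ S) * f x ≡ χ (x ≟ s) * f x + χ (x ∈? S) * f x
      split x = ≡.trans (≡.cong (_* f x) (χ-∈-∷ (x ≟ s))) (*-distribʳ-+ (f x) (χ (x ≟ s)) _)

module Arithmetic where
  open import Data.Nat using (_+_; _*_; _∸_; _≤_; z≤n; s≤s)
  open import Data.Nat.Properties
    using (+-assoc; +-identityʳ; +-cancelʳ-≡; +-mono-≤; m∸n≤m; m+[n∸m]≡n; ≤-trans)
  open import Data.Nat.Tactic.RingSolver using (solve-∀)
  open import Data.Sum using (_⊎_; inj₁; inj₂)

  nine-minus-at-most-three : ∀ {U X} e → e ≤ 3 → U + 9 ≡ X + e →
    (U + 9 ≡ X) ⊎ (U + 8 ≡ X) ⊎ (U + 7 ≡ X) ⊎ (U + 6 ≡ X)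
  nine-minus-at-most-three {U} {X} 0 _ eq = inj₁ (≡.trans eq (+-identityʳ X))
  nine-minus-at-most-three {U} {X} 1 _ eq = inj₂ (inj₁ (+-cancelʳ-≡ 1 _ _ (≡.trans (+-assoc U 8 1) eq)))
  nine-minus-at-most-three {U} {X} 2 _ eq = inj₂ (inj₂ (inj₁ (+-cancelʳ-≡ 2 _ _ (≡.trans (+-assoc U 7 2) eq))))
  nine-minus-at-most-three {U} {X} 3 _ eq = inj₂ (inj₂ (inj₂ (+-cancelʳ-≡ 3 _ _ (≡.trans (+-assoc U 6 3) eq))))
  nine-minus-at-most-three (suc (suc (suc (suc _)))) (s≤s (s≤s (s≤s ()))) _

  range-from-counts : ∀ {U T a b c q} → T ≤ a → a ≤ 1 → b ≤ 1 → c ≤ 1 →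
    U + (12 + T) ≡ 3 * (q + 1) + (a + (b + c)) →
    (U + 9 ≡ 3 * q) ⊎ (U + 8 ≡ 3 * q) ⊎ (U + 7 ≡ 3 * q) ⊎ (U + 6 ≡ 3 * q)
  range-from-counts {U} {T} {a} {b} {c} {q} T≤a a≤1 b≤1 c≤1 counts =
    nine-minus-at-most-three (a ∸ T + (b + c))
      (+-mono-≤ (≤-trans (m∸n≤m a T) a≤1) (+-mono-≤ b≤1 c≤1))
      (+-cancelʳ-≡ (T + 3) _ _ (begin
        U + 9 + (T + 3)                        ≡⟨ shift-left U T ⟩
        U + (12 + T)                           ≡⟨ counts ⟩
        3 * (q + 1) + (a + (b + c))            ≡⟨ ≡.cong (λ a → 3 * (q + 1) + (a + (b + c))) (m+[n∸m]≡n T≤a) ⟨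
        3 * (q + 1) + (T + (a ∸ T) + (b + c))  ≡⟨ shift-right q T (a ∸ T) b c ⟩
        3 * q + (a ∸ T + (b + c)) + (T + 3)    ∎))
    where
    open ≡.≡-Reasoning
    shift-left : ∀ U T → U + 9 + (T + 3) ≡ U + (12 + T)
    shift-left = solve-∀
    shift-right : ∀ q T d b c → 3 * (q + 1) + (T + d + (b + c)) ≡ 3 * q + (d + (b + c)) + (T + 3)
    shift-right = solve-∀

module ProjectivePlane (F : FiniteField) where
  open FiniteField F
  open PG2 F
  open Counting
  open import Data.Integer using (0ℤ; 1ℤ)
  open import Data.List using (allFin)
  open import Data.List.Membership.Propositional.Properties using (∈-map⁺; ∈-allFin)
  open import Data.List.Properties using (length-map; length-tabulate)
  open import Data.List.Relation.Unary.Unique.Propositional.Properties using (map⁺; allFin⁺)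
  open import Function using (id)
  open import Function.Bundles using (Inverse)
  open import Level using (0ℓ)

  commutativeRing : CommutativeRing 0ℓ 0ℓ
  commutativeRing = record { isCommutativeRing = isCommutativeRing }

  open CommutativeRing commutativeRing
    using (_-_; +-identityˡ; *-identityˡ; *-comm; zeroʳ; +-abelianGroup)
  open import Algebra.Properties.AbelianGroup +-abelianGroup using (x∙y⁻¹≈ε⇒x≈y; ⁻¹-involutive; ε⁻¹≈ε)
  open IntegerCoefficientSolver commutativeRing using (solve; _:=_; _:+_; _:*_; _:-_; :-_; con)

  Vector : Set
  Vector = Carrier × Carrier × Carrier

  IsZero : Vector → Set
  IsZero (x₀ , x₁ , x₂) = x₀ ≡ 0# × x₁ ≡ 0# × x₂ ≡ 0#

  isZero? : ∀ v → Dec (IsZero v)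
  isZero? (x₀ , x₁ , x₂) = (x₀ ≟ 0#) ×-dec (x₁ ≟ 0#) ×-dec (x₂ ≟ 0#)

  _·ᵥ_ : Carrier → Vector → Vector
  k ·ᵥ (x₀ , x₁ , x₂) = k * x₀ , k * x₁ , k * x₂

  cross : Vector → Vector → Vector
  cross (a₀ , a₁ , a₂) (b₀ , b₁ , b₂) = a₁ * b₂ - a₂ * b₁ , a₂ * b₀ - a₀ * b₂ , a₀ * b₁ - a₁ * b₀

  1#≢0# : 1# ≢ 0#
  1#≢0# = 0≢1 ∘ ≡.sym

  -1#≢0# : - 1# ≢ 0#
  -1#≢0# -1≡0 = 1#≢0# (begin
    1#       ≡⟨ ⁻¹-involutive 1# ⟨
    - - 1#   ≡⟨ ≡.cong -_ -1≡0 ⟩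
    - 0#     ≡⟨ ε⁻¹≈ε ⟩
    0#       ∎)
    where open ≡.≡-Reasoning

  form-sym : ∀ u x → form u x ≡ form x u
  form-sym (u₀ , u₁ , u₂) (x₀ , x₁ , x₂) =
    solve 6 (λ u₀ u₁ u₂ x₀ x₁ x₂ → u₀ :* x₀ :+ u₁ :* x₁ :+ u₂ :* x₂ := x₀ :* u₀ :+ x₁ :* u₁ :+ x₂ :* u₂)
      ≡.refl u₀ u₁ u₂ x₀ x₁ x₂

  incident-sym : ∀ {m P} → Incident m P → Incident P m
  incident-sym {m} {P} = ≡.trans (form-sym (coords P) (coords m))

  form-scale : ∀ k v x → form (k ·ᵥ v) x ≡ k * form v x
  form-scale k (v₀ , v₁ , v₂) (x₀ , x₁ , x₂) =
    solve 7 (λ k v₀ v₁ v₂ x₀ x₁ x₂ →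
               k :* v₀ :* x₀ :+ k :* v₁ :* x₁ :+ k :* v₂ :* x₂ := k :* (v₀ :* x₀ :+ v₁ :* x₁ :+ v₂ :* x₂))
      ≡.refl k v₀ v₁ v₂ x₀ x₁ x₂

  form-crossˡ : ∀ a b → form (cross a b) a ≡ 0#
  form-crossˡ (a₀ , a₁ , a₂) (b₀ , b₁ , b₂) =
    solve 6 (λ a₀ a₁ a₂ b₀ b₁ b₂ →
               (a₁ :* b₂ :- a₂ :* b₁) :* a₀ :+ (a₂ :* b₀ :- a₀ :* b₂) :* a₁ :+ (a₀ :* b₁ :- a₁ :* b₀) :* a₂
                 := con 0ℤ)
      ≡.refl a₀ a₁ a₂ b₀ b₁ b₂

  form-crossʳ : ∀ a b → form (cross a b) b ≡ 0#
  form-crossʳ (a₀ , a₁ , a₂) (b₀ , b₁ , b₂) =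
    solve 6 (λ a₀ a₁ a₂ b₀ b₁ b₂ →
               (a₁ :* b₂ :- a₂ :* b₁) :* b₀ :+ (a₂ :* b₀ :- a₀ :* b₂) :* b₁ :+ (a₀ :* b₁ :- a₁ :* b₀) :* b₂
                 := con 0ℤ)
      ≡.refl a₀ a₁ a₂ b₀ b₁ b₂

  -- x × (m × n) = (n · x) m - (m · x) n, componentwise.
  cross-cross-zero : ∀ x m n → form m x ≡ 0# → form n x ≡ 0# → IsZero (cross x (cross m n))
  cross-cross-zero (x₀ , x₁ , x₂) (m₀ , m₁ , m₂) (n₀ , n₁ , n₂) m·x≡0 n·x≡0 =
    vanish m₀ n₀ (solve 9 (λ x₀ x₁ x₂ m₀ m₁ m₂ n₀ n₁ n₂ →
      x₁ :* (m₀ :* n₁ :- m₁ :* n₀) :- x₂ :* (m₂ :* n₀ :- m₀ :* n₂)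
        := m₀ :* (n₀ :* x₀ :+ n₁ :* x₁ :+ n₂ :* x₂) :- n₀ :* (m₀ :* x₀ :+ m₁ :* x₁ :+ m₂ :* x₂))
      ≡.refl x₀ x₁ x₂ m₀ m₁ m₂ n₀ n₁ n₂) ,
    vanish m₁ n₁ (solve 9 (λ x₀ x₁ x₂ m₀ m₁ m₂ n₀ n₁ n₂ →
      x₂ :* (m₁ :* n₂ :- m₂ :* n₁) :- x₀ :* (m₀ :* n₁ :- m₁ :* n₀)
        := m₁ :* (n₀ :* x₀ :+ n₁ :* x₁ :+ n₂ :* x₂) :- n₁ :* (m₀ :* x₀ :+ m₁ :* x₁ :+ m₂ :* x₂))
      ≡.refl x₀ x₁ x₂ m₀ m₁ m₂ n₀ n₁ n₂) ,
    vanish m₂ n₂ (solve 9 (λ x₀ x₁ x₂ m₀ m₁ m₂ n₀ n₁ n₂ →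
      x₀ :* (m₂ :* n₀ :- m₀ :* n₂) :- x₁ :* (m₁ :* n₂ :- m₂ :* n₁)
        := m₂ :* (n₀ :* x₀ :+ n₁ :* x₁ :+ n₂ :* x₂) :- n₂ :* (m₀ :* x₀ :+ m₁ :* x₁ :+ m₂ :* x₂))
      ≡.refl x₀ x₁ x₂ m₀ m₁ m₂ n₀ n₁ n₂)
    where
    vanish : ∀ {e} a b →
      e ≡ a * form (n₀ , n₁ , n₂) (x₀ , x₁ , x₂) - b * form (m₀ , m₁ , m₂) (x₀ , x₁ , x₂) → e ≡ 0#
    vanish a b e≡ = ≡.trans e≡ (≡.trans (≡.cong₂ (λ s t → a * s - b * t) n·x≡0 m·x≡0)
                                        (solve 2 (λ a b → a :* con 0ℤ :- b :* con 0ℤ := con 0ℤ) ≡.refl a b))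

  cross-scaleʳ-zero : ∀ x k v → IsZero (cross x v) → IsZero (cross x (k ·ᵥ v))
  cross-scaleʳ-zero (x₀ , x₁ , x₂) k (v₀ , v₁ , v₂) (z₀ , z₁ , z₂) =
    scaled x₁ v₂ x₂ v₁ z₀ , scaled x₂ v₀ x₀ v₂ z₁ , scaled x₀ v₁ x₁ v₀ z₂
    where
    scaled : ∀ a b c d → a * b - c * d ≡ 0# → a * (k * b) - c * (k * d) ≡ 0#
    scaled a b c d ab-cd≡0 = begin
      a * (k * b) - c * (k * d)
        ≡⟨ solve 5 (λ k a b c d → a :* (k :* b) :- c :* (k :* d) := k :* (a :* b :- c :* d)) ≡.refl k a b c d ⟩
      k * (a * b - c * d)
        ≡⟨ ≡.cong (k *_) ab-cd≡0 ⟩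
      k * 0#
        ≡⟨ zeroʳ k ⟩
      0# ∎
      where open ≡.≡-Reasoning

  private
    1x-y1 : ∀ x y → 1# * x - y * 1# ≡ x - y
    1x-y1 = solve 2 (λ x y → con 1ℤ :* x :- y :* con 1ℤ := x :- y) ≡.refl
    x1-1y : ∀ x y → x * 1# - 1# * y ≡ x - y
    x1-1y = solve 2 (λ x y → x :* con 1ℤ :- con 1ℤ :* y := x :- y) ≡.refl
    11-x0≢0 : ∀ x → 1# * 1# - x * 0# ≢ 0#
    11-x0≢0 x = 1#≢0# ∘ ≡.trans (solve 1 (λ x → con 1ℤ := con 1ℤ :* con 1ℤ :- x :* con 0ℤ) ≡.refl x)
    11-0x≢0 : ∀ x → 1# * 1# - 0# * x ≢ 0#
    11-0x≢0 x = 1#≢0# ∘ ≡.trans (solve 1 (λ x → con 1ℤ := con 1ℤ :* con 1ℤ :- con 0ℤ :* x) ≡.refl x)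
    x0-11≢0 : ∀ x → x * 0# - 1# * 1# ≢ 0#
    x0-11≢0 x = -1#≢0# ∘ ≡.trans (solve 1 (λ x → :- con 1ℤ := x :* con 0ℤ :- con 1ℤ :* con 1ℤ) ≡.refl x)
    0x-11≢0 : ∀ x → 0# * x - 1# * 1# ≢ 0#
    0x-11≢0 x = -1#≢0# ∘ ≡.trans (solve 1 (λ x → :- con 1ℤ := con 0ℤ :* x :- con 1ℤ :* con 1ℤ) ≡.refl x)

  coords-cross-zero⇒≡ : ∀ P Q → IsZero (cross (coords P) (coords Q)) → P ≡ Q
  coords-cross-zero⇒≡ (pt₁ a b) (pt₁ c d) (_ , z₁ , z₂) =
    ≡.cong₂ pt₁ (≡.sym (x∙y⁻¹≈ε⇒x≈y c a (≡.trans (≡.sym (1x-y1 c a)) z₂)))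
                (x∙y⁻¹≈ε⇒x≈y b d (≡.trans (≡.sym (x1-1y b d)) z₁))
  coords-cross-zero⇒≡ (pt₁ a b) (pt₂ c)   (_ , _ , z₂) = ⊥-elim (11-x0≢0 a z₂)
  coords-cross-zero⇒≡ (pt₁ a b) pt₃       (_ , z₁ , _) = ⊥-elim (x0-11≢0 b z₁)
  coords-cross-zero⇒≡ (pt₂ a)   (pt₁ b c) (_ , _ , z₂) = ⊥-elim (0x-11≢0 b z₂)
  coords-cross-zero⇒≡ (pt₂ a)   (pt₂ b)   (z₀ , _ , _) =
    ≡.cong pt₂ (≡.sym (x∙y⁻¹≈ε⇒x≈y b a (≡.trans (≡.sym (1x-y1 b a)) z₀)))
  coords-cross-zero⇒≡ (pt₂ a)   pt₃       (z₀ , _ , _) = ⊥-elim (11-x0≢0 a z₀)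
  coords-cross-zero⇒≡ pt₃       (pt₁ a b) (_ , z₁ , _) = ⊥-elim (11-0x≢0 b z₁)
  coords-cross-zero⇒≡ pt₃       (pt₂ a)   (z₀ , _ , _) = ⊥-elim (0x-11≢0 a z₀)
  coords-cross-zero⇒≡ pt₃       pt₃       _            = ≡.refl

  normalise : ∀ v → ¬ IsZero v → ∃₂ λ P k → coords P ≡ k ·ᵥ v
  normalise (v₀ , v₁ , v₂) v≢0 with v₀ ≟ 0# | v₁ ≟ 0# | v₂ ≟ 0#
  ... | no v₀≢0 | _ | _ with inverse v₀ v₀≢0
  ...   | k , v₀k≡1 =
    pt₁ (k * v₁) (k * v₂) , k , ≡.cong (_, k * v₁ , k * v₂) (≡.trans (≡.sym v₀k≡1) (*-comm v₀ k))
  normalise (v₀ , v₁ , v₂) v≢0 | yes ≡.refl | no v₁≢0 | _ with inverse v₁ v₁≢0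
  ...   | k , v₁k≡1 =
    pt₂ (k * v₂) , k , ≡.cong₂ (λ x y → x , y , k * v₂) (≡.sym (zeroʳ k)) (≡.trans (≡.sym v₁k≡1) (*-comm v₁ k))
  normalise (v₀ , v₁ , v₂) v≢0 | yes ≡.refl | yes ≡.refl | no v₂≢0 with inverse v₂ v₂≢0
  ...   | k , v₂k≡1 =
    pt₃ , k , ≡.cong₂ (λ x y → x , x , y) (≡.sym (zeroʳ k)) (≡.trans (≡.sym v₂k≡1) (*-comm v₂ k))
  normalise (v₀ , v₁ , v₂) v≢0 | yes v₀≡0 | yes v₁≡0 | yes v₂≡0 = ⊥-elim (v≢0 (v₀≡0 , v₁≡0 , v₂≡0))

  incident-normalise : ∀ v (v≢0 : ¬ IsZero v) P → form v (coords P) ≡ 0# → Incident (proj₁ (normalise v v≢0)) P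
  incident-normalise v v≢0 P v·P≡0 with normalise v v≢0
  ... | m , k , m≡kv = begin
    form (coords m) (coords P)  ≡⟨ ≡.cong (λ u → form u (coords P)) m≡kv ⟩
    form (k ·ᵥ v) (coords P)    ≡⟨ form-scale k v (coords P) ⟩
    k * form v (coords P)       ≡⟨ ≡.cong (k *_) v·P≡0 ⟩
    k * 0#                      ≡⟨ zeroʳ k ⟩
    0#                          ∎
    where open ≡.≡-Reasoning

  normalise-parallel : ∀ c (c≢0 : ¬ IsZero c) P → IsZero (cross (coords P) c) → P ≡ proj₁ (normalise c c≢0)
  normalise-parallel c c≢0 P P×c≡0 with normalise c c≢0
  ... | N , k , N≡kc = coords-cross-zero⇒≡ P N
    (≡.subst (λ u → IsZero (cross (coords P) u)) (≡.sym N≡kc) (cross-scaleʳ-zero (coords P) k c P×c≡0))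

  join-independent : ∀ P Q → ¬ IsZero (cross (coords P) (coords Q)) → ∃ λ m → Incident m P × Incident m Q
  join-independent P Q P×Q≢0 =
    proj₁ (normalise _ P×Q≢0) ,
    incident-normalise _ P×Q≢0 P (form-crossˡ (coords P) (coords Q)) ,
    incident-normalise _ P×Q≢0 Q (form-crossʳ (coords P) (coords Q))

  another : Point → Point
  another (pt₁ _ _) = pt₃
  another (pt₂ _)   = pt₃
  another pt₃       = pt₂ 0#

  another-≢ : ∀ P → P ≢ another P
  another-≢ (pt₁ _ _) ()
  another-≢ (pt₂ _)   ()
  another-≢ pt₃       ()

  line-through : ∀ P → ∃ λ m → Incident m P
  line-through P = m , mP
    where
    m,mP,_ = join-independent P (another P) (another-≢ P ∘ coords-cross-zero⇒≡ P (another P))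
    m = proj₁ m,mP,_
    mP = proj₁ (proj₂ m,mP,_)

  join : ∀ P Q → ∃ λ m → Incident m P × Incident m Q
  join P Q with isZero? (cross (coords P) (coords Q))
  ... | no P×Q≢0  = join-independent P Q P×Q≢0
  ... | yes P×Q≡0 with coords-cross-zero⇒≡ P Q P×Q≡0
  ...   | ≡.refl = proj₁ (line-through P) , proj₂ (line-through P) , proj₂ (line-through P)

  -- P and Q are both proportional to m × m′, which is non-zero as m ≢ m′.
  join-unique : ∀ {m m′ P Q} → m ≢ m′ →
    Incident m P → Incident m Q → Incident m′ P → Incident m′ Q → P ≡ Q
  join-unique {m} {m′} {P} {Q} m≢m′ mP mQ m′P m′Q with isZero? (cross (coords m) (coords m′))
  ... | yes m×m′≡0 = ⊥-elim (m≢m′ (coords-cross-zero⇒≡ m m′ m×m′≡0))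
  ... | no m×m′≢0 = ≡.trans (on-normal P mP m′P) (≡.sym (on-normal Q mQ m′Q))
    where
    on-normal : ∀ X → Incident m X → Incident m′ X → X ≡ proj₁ (normalise _ m×m′≢0)
    on-normal X mX m′X = normalise-parallel _ m×m′≢0 X (cross-cross-zero (coords X) (coords m) (coords m′) mX m′X)

  _≟ₚ_ : DecidableEquality Point
  pt₁ a b ≟ₚ pt₁ c d with a ≟ c | b ≟ d
  ... | yes ≡.refl | yes ≡.refl = yes ≡.refl
  ... | no a≢c     | _          = no λ { ≡.refl → a≢c ≡.refl }
  ... | yes _      | no b≢d     = no λ { ≡.refl → b≢d ≡.refl }
  pt₁ _ _ ≟ₚ pt₂ _ = no λ ()
  pt₁ _ _ ≟ₚ pt₃   = no λ ()
  pt₂ _   ≟ₚ pt₁ _ _ = no λ ()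
  pt₂ a   ≟ₚ pt₂ b with a ≟ b
  ... | yes ≡.refl = yes ≡.refl
  ... | no a≢b     = no λ { ≡.refl → a≢b ≡.refl }
  pt₂ _   ≟ₚ pt₃   = no λ ()
  pt₃     ≟ₚ pt₁ _ _ = no λ ()
  pt₃     ≟ₚ pt₂ _ = no λ ()
  pt₃     ≟ₚ pt₃   = yes ≡.refl

  elements-enumerates : Enumerates _≟_ elements
  elements-enumerates = unique⇒enumerates _≟_ (map⁺ from-injective (allFin⁺ size)) complete
    where
    open Inverse enum using (to; from; strictlyInverseˡ; strictlyInverseʳ)
    from-injective : ∀ {i j} → from i ≡ from j → i ≡ j
    from-injective {i} {j} eq = ≡.trans (≡.sym (strictlyInverseˡ i)) (≡.trans (≡.cong to eq) (strictlyInverseˡ j))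
    complete : ∀ c → c ∈ elements
    complete c = ≡.subst (_∈ elements) (strictlyInverseʳ c) (∈-map⁺ from (∈-allFin (to c)))

  elements-length : length elements ≡ size
  elements-length = ≡.trans (length-map _ (allFin size)) (length-tabulate id)

  ∑-elements-const : ∀ k → ∑[ _ ∈ elements ] k ≡ size ℕ.* k
  ∑-elements-const k = ≡.trans (∑-const elements k) (≡.cong (ℕ._* k) elements-length)

  ∑-allPoints : ∀ f → ∑ allPoints f ≡
    ∑[ a ∈ elements ] ∑[ b ∈ elements ] f (pt₁ a b) ℕ.+ (∑[ c ∈ elements ] f (pt₂ c) ℕ.+ f pt₃)
  ∑-allPoints f = ≡.trans (∑-++ (concatMap (λ a → map (pt₁ a) elements) elements) (map pt₂ elements ++ pt₃ ∷ []) f)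
    (≡.cong₂ ℕ._+_ (≡.trans (∑-concatMap (λ a → map (pt₁ a) elements) elements f)
                            (∑-cong elements (λ a → ∑-map (pt₁ a) elements f)))
                   (≡.trans (∑-++ (map pt₂ elements) (pt₃ ∷ []) f)
                            (≡.cong₂ ℕ._+_ (∑-map pt₂ elements f) (ℕ.+-identityʳ (f pt₃)))))

  ∑-allPoints-from-parts : ∀ {f : Point → ℕ} {a b c n} →
    ∑[ x ∈ elements ] ∑[ y ∈ elements ] f (pt₁ x y) ≡ a → ∑[ z ∈ elements ] f (pt₂ z) ≡ b → f pt₃ ≡ c →
    a ℕ.+ (b ℕ.+ c) ≡ n → ∑ allPoints f ≡ n
  ∑-allPoints-from-parts {f} affine at-infinity at-pt₃ sum≡n =
    ≡.trans (∑-allPoints f) (≡.trans (≡.cong₂ ℕ._+_ affine (≡.cong₂ ℕ._+_ at-infinity at-pt₃)) sum≡n)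

  ∑-elements-zero : ∑[ _ ∈ elements ] 0 ≡ 0
  ∑-elements-zero = ≡.trans (∑-elements-const 0) (ℕ.*-zeroʳ size)

  allPoints-enumerates : Enumerates _≟ₚ_ allPoints
  allPoints-enumerates (pt₁ a b) = ∑-allPoints-from-parts affine ∑-elements-zero ≡.refl ≡.refl
    where
    open ≡.≡-Reasoning
    χ-pt₁ : ∀ a′ b′ → χ (pt₁ a′ b′ ≟ₚ pt₁ a b) ≡ χ (a′ ≟ a) ℕ.* χ (b′ ≟ b)
    χ-pt₁ a′ b′ with a′ ≟ a | b′ ≟ b
    ... | yes ≡.refl | yes ≡.refl = ≡.refl
    ... | yes ≡.refl | no _       = ≡.refl
    ... | no _       | _          = ≡.refl
    affine : ∑[ a′ ∈ elements ] ∑[ b′ ∈ elements ] χ (pt₁ a′ b′ ≟ₚ pt₁ a b) ≡ 1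
    affine = begin
      ∑[ a′ ∈ elements ] ∑[ b′ ∈ elements ] χ (pt₁ a′ b′ ≟ₚ pt₁ a b)
        ≡⟨ ∑-cong elements (λ a′ → ∑-cong elements (χ-pt₁ a′)) ⟩
      ∑[ a′ ∈ elements ] ∑[ b′ ∈ elements ] (χ (a′ ≟ a) ℕ.* χ (b′ ≟ b))
        ≡⟨ ∑-cong elements (λ a′ → ∑-*ˡ elements (χ (a′ ≟ a)) (λ b′ → χ (b′ ≟ b))) ⟩
      ∑[ a′ ∈ elements ] (χ (a′ ≟ a) ℕ.* ∑[ b′ ∈ elements ] χ (b′ ≟ b))
        ≡⟨ ∑-pick _≟_ elements elements-enumerates a (λ _ → ∑[ b′ ∈ elements ] χ (b′ ≟ b)) ⟩
      ∑[ b′ ∈ elements ] χ (b′ ≟ b)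
        ≡⟨ elements-enumerates b ⟩
      1 ∎
  allPoints-enumerates (pt₂ c) = ∑-allPoints-from-parts affine at-infinity ≡.refl ≡.refl
    where
    affine : ∑[ a ∈ elements ] ∑[ b ∈ elements ] χ (pt₁ a b ≟ₚ pt₂ c) ≡ 0
    affine = ≡.trans (∑-cong elements (λ _ → ∑-elements-zero)) ∑-elements-zero
    at-infinity : ∑[ c′ ∈ elements ] χ (pt₂ c′ ≟ₚ pt₂ c) ≡ 1
    at-infinity = ≡.trans (∑-cong elements χ-pt₂) (elements-enumerates c)
      where
      χ-pt₂ : ∀ c′ → χ (pt₂ c′ ≟ₚ pt₂ c) ≡ χ (c′ ≟ c)
      χ-pt₂ c′ with c′ ≟ c
      ... | yes ≡.refl = ≡.refl
      ... | no _       = ≡.refl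
  allPoints-enumerates pt₃ =
    ∑-allPoints-from-parts (≡.trans (∑-cong elements (λ _ → ∑-elements-zero)) ∑-elements-zero) ∑-elements-zero ≡.refl ≡.refl

  allPoints-complete : ∀ P → P ∈ allPoints
  allPoints-complete = enumerates⇒∈ _≟ₚ_ allPoints allPoints-enumerates

  χ₀ : Carrier → ℕ
  χ₀ e = χ (e ≟ 0#)

  ∑-affine-root : ∀ {α} β → α ≢ 0# → ∑[ x ∈ elements ] χ₀ (β + α * x) ≡ 1
  ∑-affine-root {α} β α≢0 with inverse α α≢0
  ... | k , αk≡1 = ≡.trans (∑-cong elements (λ x → χ-cong ((β + α * x) ≟ 0#) (x ≟ root) (unique x) (is-root x)))
                           (elements-enumerates root)
    where
    open ≡.≡-Reasoning
    root : Carrier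
    root = - (k * β)
    unique : ∀ x → β + α * x ≡ 0# → x ≡ root
    unique x β+αx≡0 = begin
      x                        ≡⟨ *-identityˡ x ⟨
      1# * x                   ≡⟨ ≡.cong (_* x) αk≡1 ⟨
      α * k * x
        ≡⟨ solve 4 (λ α k x β → α :* k :* x := k :* (β :+ α :* x) :- k :* β) ≡.refl α k x β ⟩
      k * (β + α * x) - k * β  ≡⟨ ≡.cong (λ e → k * e - k * β) β+αx≡0 ⟩
      k * 0# - k * β           ≡⟨ solve 2 (λ k β → k :* con 0ℤ :- k :* β := :- (k :* β)) ≡.refl k β ⟩
      - (k * β)                ∎
    is-root : ∀ x → x ≡ root → β + α * x ≡ 0#
    is-root x ≡.refl = begin
      β + α * - (k * β)
        ≡⟨ solve 3 (λ α k β → β :+ α :* :- (k :* β) := β :- α :* k :* β) ≡.refl α k β ⟩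
      β - α * k * β            ≡⟨ ≡.cong (λ e → β - e * β) αk≡1 ⟩
      β - 1# * β               ≡⟨ solve 1 (λ β → β :- con 1ℤ :* β := con 0ℤ) ≡.refl β ⟩
      0#                       ∎

  ∑-constant-root : ∀ β → ∑[ x ∈ elements ] χ₀ (β + 0# * x) ≡ size ℕ.* χ₀ β
  ∑-constant-root β = ≡.trans (∑-cong elements (λ x → ≡.cong χ₀ (β+0x≡β x))) (∑-elements-const _)
    where
    β+0x≡β : ∀ x → β + 0# * x ≡ β
    β+0x≡β = solve 2 (λ β x → β :+ con 0ℤ :* x := β) ≡.refl β

  ∑-points-on : ∀ v → ¬ IsZero v → ∑[ P ∈ allPoints ] χ₀ (form v (coords P)) ≡ size ℕ.+ 1
  ∑-points-on v@(v₀ , v₁ , v₂) v≢0 with v₂ ≟ 0# | v₁ ≟ 0# | v₀ ≟ 0#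
  ... | no v₂≢0 | _ | _ = ∑-allPoints-from-parts affine at-infinity at-pt₃ (≡.cong (ℕ._+ 1) (ℕ.*-identityʳ size))
    where
    affine : ∑[ a ∈ elements ] ∑[ b ∈ elements ] χ₀ (form v (coords (pt₁ a b))) ≡ size ℕ.* 1
    affine = ≡.trans (∑-cong elements λ _ → ∑-affine-root _ v₂≢0) (∑-elements-const 1)
    at-infinity : ∑[ c ∈ elements ] χ₀ (form v (coords (pt₂ c))) ≡ 1
    at-infinity = ∑-affine-root _ v₂≢0
    at-pt₃ : χ₀ (form v (coords pt₃)) ≡ 0
    at-pt₃ = χ-no _ (v₂≢0 ∘ ≡.trans
      (solve 3 (λ v₀ v₁ v₂ → v₂ := v₀ :* con 0ℤ :+ v₁ :* con 0ℤ :+ v₂ :* con 1ℤ) ≡.refl v₀ v₁ v₂))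
  ... | yes ≡.refl | no v₁≢0 | _ =
    ∑-allPoints-from-parts affine at-infinity at-pt₃ (≡.cong₂ ℕ._+_ (ℕ.*-identityʳ size) (≡.cong (ℕ._+ 1) (ℕ.*-zeroʳ size)))
    where
    affine : ∑[ a ∈ elements ] ∑[ b ∈ elements ] χ₀ (form v (coords (pt₁ a b))) ≡ size ℕ.* 1
    affine = ≡.trans (∑-cong elements λ _ → ∑-constant-root _)
                     (≡.trans (∑-*ˡ elements size _) (≡.cong (size ℕ.*_) (∑-affine-root _ v₁≢0)))
    at-infinity : ∑[ c ∈ elements ] χ₀ (form v (coords (pt₂ c))) ≡ size ℕ.* 0
    at-infinity = ≡.trans (∑-constant-root _) (≡.cong (size ℕ.*_)
      (χ-no _ (v₁≢0 ∘ ≡.trans (solve 2 (λ v₀ v₁ → v₁ := v₀ :* con 0ℤ :+ v₁ :* con 1ℤ) ≡.refl v₀ v₁))))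
    at-pt₃ : χ₀ (form v (coords pt₃)) ≡ 1
    at-pt₃ = χ-yes _
      (solve 2 (λ v₀ v₁ → v₀ :* con 0ℤ :+ v₁ :* con 0ℤ :+ con 0ℤ :* con 1ℤ := con 0ℤ) ≡.refl v₀ v₁)
  ... | yes ≡.refl | yes ≡.refl | no v₀≢0 =
    ∑-allPoints-from-parts affine at-infinity at-pt₃ (≡.cong (ℕ._+ 1) (ℕ.*-identityʳ size))
    where
    affine : ∑[ a ∈ elements ] ∑[ b ∈ elements ] χ₀ (form v (coords (pt₁ a b))) ≡ 0
    affine = ≡.trans (∑-cong elements λ a → ≡.trans (∑-constant-root _) (≡.trans (≡.cong (size ℕ.*_)
               (χ-no _ (v₀≢0 ∘ ≡.trans (solve 2 (λ v₀ a → v₀ := v₀ :* con 1ℤ :+ con 0ℤ :* a) ≡.refl v₀ a))))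
               (ℕ.*-zeroʳ size)))
             ∑-elements-zero
    at-infinity : ∑[ c ∈ elements ] χ₀ (form v (coords (pt₂ c))) ≡ size ℕ.* 1
    at-infinity = ≡.trans (∑-constant-root _) (≡.cong (size ℕ.*_)
      (χ-yes _ (solve 1 (λ v₀ → v₀ :* con 0ℤ :+ con 0ℤ :* con 1ℤ := con 0ℤ) ≡.refl v₀)))
    at-pt₃ : χ₀ (form v (coords pt₃)) ≡ 1
    at-pt₃ = χ-yes _
      (solve 1 (λ v₀ → v₀ :* con 0ℤ :+ con 0ℤ :* con 0ℤ :+ con 0ℤ :* con 1ℤ := con 0ℤ) ≡.refl v₀)
  ... | yes v₂≡0 | yes v₁≡0 | yes v₀≡0 = ⊥-elim (v≢0 (v₀≡0 , v₁≡0 , v₂≡0))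

  coords-nonzero : ∀ P → ¬ IsZero (coords P)
  coords-nonzero (pt₁ _ _) = 1#≢0# ∘ proj₁
  coords-nonzero (pt₂ _)   = 1#≢0# ∘ proj₁ ∘ proj₂
  coords-nonzero pt₃       = 1#≢0# ∘ proj₂ ∘ proj₂

module Incidences (F : FiniteField) where
  open FiniteField F using (size)
  open PG2 F
  open ProjectivePlane F
    using (_≟ₚ_; incident-sym; join; join-unique; allPoints-enumerates; ∑-points-on; coords-nonzero)
  open Counting
  open import Data.Nat using (_+_; _*_; _<_)
  open import Data.Nat.Properties using (*-comm)
  open import Data.List.Membership.Propositional.Properties using (∈-filter⁺; ∈-length)

  [_∋_] : Line → Point → ℕ
  [ m ∋ P ] = χ (incident? m P)

  pencil : Point → List Line
  pencil P = filter (λ m → incident? m P) allPoints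

  ∑-pencil : ∀ P (f : Line → ℕ) → ∑ (pencil P) f ≡ ∑[ m ∈ allPoints ] ([ m ∋ P ] * f m)
  ∑-pencil P = ∑-filter (λ m → incident? m P) allPoints

  ∋-sym : ∀ m P → [ m ∋ P ] ≡ [ P ∋ m ]
  ∋-sym m P = χ-cong (incident? m P) (incident? P m) (incident-sym {m} {P}) (incident-sym {P} {m})

  points-on : ∀ ℓ → ∑[ P ∈ allPoints ] [ ℓ ∋ P ] ≡ size + 1
  points-on ℓ = ∑-points-on (coords ℓ) (coords-nonzero ℓ)

  length-pencil : ∀ P → length (pencil P) ≡ size + 1
  length-pencil P = begin
    length (pencil P)              ≡⟨ length-filter-∑ (λ m → incident? m P) allPoints ⟩
    ∑[ m ∈ allPoints ] [ m ∋ P ]   ≡⟨ ∑-cong allPoints (λ m → ∋-sym m P) ⟩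
    ∑[ m ∈ allPoints ] [ P ∋ m ]   ≡⟨ points-on P ⟩
    size + 1                       ∎
    where open ≡.≡-Reasoning

  pencil-∋ : ∀ {P ℓ} → Incident ℓ P → ∑[ m ∈ pencil P ] χ (m ≟ₚ ℓ) ≡ 1
  pencil-∋ {P} {ℓ} ℓP = begin
    ∑[ m ∈ pencil P ] χ (m ≟ₚ ℓ)                    ≡⟨ ∑-pencil P (λ m → χ (m ≟ₚ ℓ)) ⟩
    ∑[ m ∈ allPoints ] ([ m ∋ P ] * χ (m ≟ₚ ℓ))     ≡⟨ ∑-cong allPoints (λ m → *-comm [ m ∋ P ] _) ⟩
    ∑[ m ∈ allPoints ] (χ (m ≟ₚ ℓ) * [ m ∋ P ])     ≡⟨ ∑-pick _≟ₚ_ allPoints allPoints-enumerates ℓ (λ m → [ m ∋ P ]) ⟩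
    [ ℓ ∋ P ]                                       ≡⟨ χ-yes (incident? ℓ P) ℓP ⟩
    1                                               ∎
    where open ≡.≡-Reasoning

  join-indicator : ∀ {X X′} → X ≢ X′ → ∃ λ m₀ → Incident m₀ X × (∀ m → [ m ∋ X ] * [ m ∋ X′ ] ≡ χ (m ≟ₚ m₀))
  join-indicator {X} {X′} X≢X′ with join X X′
  ... | m₀ , m₀X , m₀X′ = m₀ , m₀X , indicator
    where
    indicator : ∀ m → [ m ∋ X ] * [ m ∋ X′ ] ≡ χ (m ≟ₚ m₀)
    indicator m with incident? m X | incident? m X′ | m ≟ₚ m₀
    ... | yes mX | yes mX′ | yes _      = ≡.refl
    ... | yes mX | yes mX′ | no m≢m₀    = ⊥-elim (X≢X′ (join-unique m≢m₀ mX mX′ m₀X m₀X′))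
    ... | yes _  | no ¬mX′ | yes ≡.refl = ⊥-elim (¬mX′ m₀X′)
    ... | no ¬mX | _       | yes ≡.refl = ⊥-elim (¬mX m₀X)
    ... | yes _  | no _    | no _       = ≡.refl
    ... | no _   | _       | no _       = ≡.refl

  lines-through-two-points : ∀ {X X′} → X ≢ X′ → ∑[ m ∈ allPoints ] ([ m ∋ X ] * [ m ∋ X′ ]) ≡ 1
  lines-through-two-points X≢X′ with join-indicator X≢X′
  ... | m₀ , _ , indicator = ≡.trans (∑-cong allPoints indicator) (allPoints-enumerates m₀)

  lines-meet-once : ∀ {ℓ m} → ℓ ≢ m → ∑[ P ∈ allPoints ] ([ ℓ ∋ P ] * [ m ∋ P ]) ≡ 1
  lines-meet-once {ℓ} {m} ℓ≢m =
    ≡.trans (∑-cong allPoints λ P → ≡.cong₂ _*_ (∋-sym ℓ P) (∋-sym m P)) (lines-through-two-points ℓ≢m)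

  pencil-through : ∀ {X P} → X ≢ P → ∑[ m ∈ pencil P ] [ m ∋ X ] ≡ 1
  pencil-through {X} {P} X≢P = begin
    ∑[ m ∈ pencil P ] [ m ∋ X ]                  ≡⟨ ∑-pencil P (λ m → [ m ∋ X ]) ⟩
    ∑[ m ∈ allPoints ] ([ m ∋ P ] * [ m ∋ X ])   ≡⟨ ∑-cong allPoints (λ m → *-comm [ m ∋ P ] _) ⟩
    ∑[ m ∈ allPoints ] ([ m ∋ X ] * [ m ∋ P ])   ≡⟨ lines-through-two-points X≢P ⟩
    1                                            ∎
    where open ≡.≡-Reasoning

  collinear : Point → Point → Point → ℕ
  collinear X X′ Y = ∑[ m ∈ pencil Y ] ([ m ∋ X ] * [ m ∋ X′ ])

  collinear-join : ∀ {X X′} → X ≢ X′ → ∃ λ m₀ → Incident m₀ X × (∀ Y → collinear X X′ Y ≡ [ m₀ ∋ Y ])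
  collinear-join {X} {X′} X≢X′ with join-indicator X≢X′
  ... | m₀ , m₀X , indicator = m₀ , m₀X , λ Y → begin
    collinear X X′ Y                                         ≡⟨ ∑-pencil Y (λ m → [ m ∋ X ] * [ m ∋ X′ ]) ⟩
    ∑[ m ∈ allPoints ] ([ m ∋ Y ] * ([ m ∋ X ] * [ m ∋ X′ ]))
      ≡⟨ ∑-cong allPoints (λ m → ≡.trans (≡.cong ([ m ∋ Y ] *_) (indicator m)) (*-comm [ m ∋ Y ] _)) ⟩
    ∑[ m ∈ allPoints ] (χ (m ≟ₚ m₀) * [ m ∋ Y ])  ≡⟨ ∑-pick _≟ₚ_ allPoints allPoints-enumerates m₀ (λ m → [ m ∋ Y ]) ⟩
    [ m₀ ∋ Y ]                                    ∎
    where open ≡.≡-Reasoning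

  _∖_ : List Point → Line → List Point
  S ∖ ℓ = filter (¬? ∘ incident? ℓ) S

  meet-+-∖ : ∀ S ℓ → meet S ℓ + length (S ∖ ℓ) ≡ length S
  meet-+-∖ S ℓ = length-filter-∁ (incident? ℓ) S

  meet-positive : ∀ {S s} m → s ∈ S → Incident m s → 0 < meet S m
  meet-positive m s∈S ms = ∈-length (∈-filter⁺ (incident? m) s∈S ms)

module ZeroSecants (F : FiniteField) (S : List (PG2.Point F)) (S! : Unique S) (ℓ : PG2.Line F) where
  open FiniteField F using (size)
  open PG2 F
  open ProjectivePlane F using (_≟ₚ_; join-unique; allPoints-enumerates)
  open Incidences F
  open Counting
  open Arithmetic using (range-from-counts)
  open import Data.List.Membership.DecPropositional _≟ₚ_ using (_∈?_)
  open import Data.List.Membership.Propositional.Properties using (∈-filter⁺; ∈-filter⁻)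
  open import Data.List.Properties using (filter-none)
  import Data.List.Relation.Unary.AllPairs as AllPairs
  open import Data.List.Relation.Unary.Unique.Propositional.Properties using (filter⁺)
  open import Data.Nat using (_+_; _*_; _≤_; _≟_)
  open import Data.Nat.Properties
    using (+-comm; +-cancelʳ-≡; *-zeroʳ; *-identityʳ; *-monoˡ-≤; *-monoʳ-≤;
           ≤-trans; ≤-reflexive; n>0⇒n≢0; module ≤-Reasoning)
  open import Data.Sum using (_⊎_)

  OnℓOffS : Point → Set
  OnℓOffS Y = Incident ℓ Y × Y ∉ S

  onℓOffS? : Decidable OnℓOffS
  onℓOffS? Y = incident? ℓ Y ×-dec ¬? (Y ∈? S)

  ℓ∖S : List Point
  ℓ∖S = filter onℓOffS? allPoints

  zeroSecantsThrough : Point → ℕ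
  zeroSecantsThrough Y = ∑[ m ∈ pencil Y ] χ (meet S m ≟ 0)

  meet≢0 : ∀ m {s} → s ∈ S → Incident m s → meet S m ≢ 0
  meet≢0 m s∈S ms = n>0⇒n≢0 (meet-positive m s∈S ms)

  zero-secant-crosses-ℓ∖S-once : meet S ℓ ≢ 0 → ∀ m → meet S m ≡ 0 → ∑[ Y ∈ ℓ∖S ] [ m ∋ Y ] ≡ 1
  zero-secant-crosses-ℓ∖S-once ℓ∩S≢0 m m∩S≡0 = begin
    ∑[ Y ∈ ℓ∖S ] [ m ∋ Y ]                           ≡⟨ ∑-filter onℓOffS? allPoints (λ Y → [ m ∋ Y ]) ⟩
    ∑[ Y ∈ allPoints ] (χ (onℓOffS? Y) * [ m ∋ Y ])  ≡⟨ ∑-cong allPoints (λ Y → off-S (incident? m Y)) ⟩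
    ∑[ Y ∈ allPoints ] ([ ℓ ∋ Y ] * [ m ∋ Y ])       ≡⟨ lines-meet-once ℓ≢m ⟩
    1                                                ∎
    where
    open ≡.≡-Reasoning
    ℓ≢m : ℓ ≢ m
    ℓ≢m ≡.refl = ℓ∩S≢0 m∩S≡0
    off-S : ∀ {Y} (mY? : Dec (Incident m Y)) → χ (onℓOffS? Y) * χ mY? ≡ [ ℓ ∋ Y ] * χ mY?
    off-S {Y} (yes mY) = ≡.cong (_* 1)
      (χ-cong (onℓOffS? Y) (incident? ℓ Y) proj₁ (λ ℓY → ℓY , λ Y∈S → meet≢0 m Y∈S mY m∩S≡0))
    off-S {Y} (no _)   = ≡.trans (*-zeroʳ (χ (onℓOffS? Y))) (≡.sym (*-zeroʳ [ ℓ ∋ Y ]))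

  u₀≡∑-zeroSecantsThrough : meet S ℓ ≢ 0 → u 0 S ≡ ∑[ Y ∈ ℓ∖S ] zeroSecantsThrough Y
  u₀≡∑-zeroSecantsThrough ℓ∩S≢0 = begin
    u 0 S
      ≡⟨ length-filter-∑ (λ m → meet S m ≟ 0) allPoints ⟩
    ∑[ m ∈ allPoints ] χ (meet S m ≟ 0)
      ≡⟨ ∑-cong allPoints (λ m → crossing m (meet S m ≟ 0)) ⟩
    ∑[ m ∈ allPoints ] (∑[ Y ∈ ℓ∖S ] [ m ∋ Y ] * χ (meet S m ≟ 0))
      ≡⟨ ∑-cong allPoints (λ m → ∑-*ʳ ℓ∖S (λ Y → [ m ∋ Y ]) _) ⟨
    ∑[ m ∈ allPoints ] ∑[ Y ∈ ℓ∖S ] ([ m ∋ Y ] * χ (meet S m ≟ 0))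
      ≡⟨ ∑-comm allPoints ℓ∖S _ ⟩
    ∑[ Y ∈ ℓ∖S ] ∑[ m ∈ allPoints ] ([ m ∋ Y ] * χ (meet S m ≟ 0))
      ≡⟨ ∑-cong ℓ∖S (λ Y → ∑-pencil Y _) ⟨
    ∑[ Y ∈ ℓ∖S ] zeroSecantsThrough Y
      ∎
    where
    open ≡.≡-Reasoning
    crossing : ∀ m (m∩S≟0 : Dec (meet S m ≡ 0)) → χ m∩S≟0 ≡ ∑[ Y ∈ ℓ∖S ] [ m ∋ Y ] * χ m∩S≟0
    crossing m (yes m∩S≡0) = ≡.cong (_* 1) (≡.sym (zero-secant-crosses-ℓ∖S-once ℓ∩S≢0 m m∩S≡0))
    crossing m (no _)      = ≡.sym (*-zeroʳ (∑[ Y ∈ ℓ∖S ] [ m ∋ Y ]))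

  length-ℓ∖S : length ℓ∖S + meet S ℓ ≡ size + 1
  length-ℓ∖S = begin
    length ℓ∖S + meet S ℓ
      ≡⟨ ≡.cong₂ _+_ (length-filter-∑ onℓOffS? allPoints)
                     (≡.trans (length-filter-∑ (incident? ℓ) S)
                              (≡.sym (∑-restrict _≟ₚ_ allPoints allPoints-enumerates S! (λ Y → [ ℓ ∋ Y ])))) ⟩
    ∑[ Y ∈ allPoints ] χ (onℓOffS? Y) + ∑[ Y ∈ allPoints ] (χ (Y ∈? S) * [ ℓ ∋ Y ])
      ≡⟨ ∑-+ allPoints _ _ ⟨
    ∑[ Y ∈ allPoints ] (χ (onℓOffS? Y) + χ (Y ∈? S) * [ ℓ ∋ Y ])
      ≡⟨ ∑-cong allPoints (λ Y → on-ℓ (incident? ℓ Y) (Y ∈? S)) ⟩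
    ∑[ Y ∈ allPoints ] [ ℓ ∋ Y ]
      ≡⟨ points-on ℓ ⟩
    size + 1 ∎
    where
    open ≡.≡-Reasoning
    on-ℓ : ∀ {Y} (ℓY? : Dec (Incident ℓ Y)) (Y∈S? : Dec (Y ∈ S)) →
           χ (ℓY? ×-dec ¬? Y∈S?) + χ Y∈S? * χ ℓY? ≡ χ ℓY?
    on-ℓ (yes _) (yes _) = ≡.refl
    on-ℓ (yes _) (no _)  = ≡.refl
    on-ℓ (no _)  (yes _) = ≡.refl
    on-ℓ (no _)  (no _)  = ≡.refl

  collinear-bound : ∀ {X X′} → X ≢ X′ → ¬ Incident ℓ X → ∑[ Y ∈ ℓ∖S ] collinear X X′ Y ≤ 1
  collinear-bound {X} {X′} X≢X′ ¬ℓX with collinear-join X≢X′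
  ... | m₀ , m₀X , collinear≡ = begin
    ∑[ Y ∈ ℓ∖S ] collinear X X′ Y                     ≡⟨ ∑-cong ℓ∖S collinear≡ ⟩
    ∑[ Y ∈ ℓ∖S ] [ m₀ ∋ Y ]                           ≡⟨ ∑-filter onℓOffS? allPoints (λ Y → [ m₀ ∋ Y ]) ⟩
    ∑[ Y ∈ allPoints ] (χ (onℓOffS? Y) * [ m₀ ∋ Y ])  ≤⟨ ∑-mono allPoints (λ Y → *-monoˡ-≤ [ m₀ ∋ Y ]
                                                             (χ-mono (onℓOffS? Y) (incident? ℓ Y) proj₁)) ⟩
    ∑[ Y ∈ allPoints ] ([ ℓ ∋ Y ] * [ m₀ ∋ Y ])       ≡⟨ lines-meet-once ℓ≢m₀ ⟩
    1                                                 ∎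
    where
    open ≤-Reasoning
    ℓ≢m₀ : ℓ ≢ m₀
    ℓ≢m₀ ≡.refl = ¬ℓX m₀X

  module ThreePointsOffℓ {A B C : Point} (S∖ℓ≡ABC : S ∖ ℓ ≡ A ∷ B ∷ C ∷ []) (ℓ∩S≢0 : meet S ℓ ≢ 0) where

    off-ℓ : ∀ {X} → X ∈ A ∷ B ∷ C ∷ [] → X ∈ S × ¬ Incident ℓ X
    off-ℓ X∈ABC = ∈-filter⁻ (¬? ∘ incident? ℓ) (≡.subst (_ ∈_) (≡.sym S∖ℓ≡ABC) X∈ABC)

    S-off-ℓ : ∀ {s} → s ∈ S → ¬ Incident ℓ s → s ∈ A ∷ B ∷ C ∷ []
    S-off-ℓ {s} s∈S ¬ℓs = ≡.subst (s ∈_) S∖ℓ≡ABC (∈-filter⁺ (¬? ∘ incident? ℓ) s∈S ¬ℓs)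

    ABC! : Unique (A ∷ B ∷ C ∷ [])
    ABC! = ≡.subst Unique S∖ℓ≡ABC (filter⁺ (¬? ∘ incident? ℓ) S!)

    A≢B : A ≢ B
    A≢B = All.lookup (AllPairs.head ABC!) (here ≡.refl)
    A≢C : A ≢ C
    A≢C = All.lookup (AllPairs.head ABC!) (there (here ≡.refl))
    B≢C : B ≢ C
    B≢C = All.lookup (AllPairs.head (AllPairs.tail ABC!)) (here ≡.refl)

    zero-secant⇔misses-ABC : ∀ {Y m} → OnℓOffS Y → Incident m Y → m ≢ ℓ →
      (meet S m ≡ 0 → ¬ Incident m A × ¬ Incident m B × ¬ Incident m C) ×
      (¬ Incident m A × ¬ Incident m B × ¬ Incident m C → meet S m ≡ 0)
    zero-secant⇔misses-ABC {Y} {m} (ℓY , Y∉S) mY m≢ℓ = misses-ABC , misses-S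
      where
      misses-ABC : meet S m ≡ 0 → ¬ Incident m A × ¬ Incident m B × ¬ Incident m C
      misses-ABC m∩S≡0 =
        (λ mA → meet≢0 m (proj₁ (off-ℓ (here ≡.refl))) mA m∩S≡0) ,
        (λ mB → meet≢0 m (proj₁ (off-ℓ (there (here ≡.refl)))) mB m∩S≡0) ,
        (λ mC → meet≢0 m (proj₁ (off-ℓ (there (there (here ≡.refl))))) mC m∩S≡0)
      misses-S : ¬ Incident m A × ¬ Incident m B × ¬ Incident m C → meet S m ≡ 0
      misses-S (¬mA , ¬mB , ¬mC) = ≡.cong length (filter-none (incident? m) (All.tabulate off-m))
        where
        off-m : ∀ {s} → s ∈ S → ¬ Incident m s
        off-m {s} s∈S ms with incident? ℓ s
        ... | yes ℓs = Y∉S (≡.subst (_∈ S) (join-unique m≢ℓ ms mY ℓs ℓY) s∈S)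
        ... | no ¬ℓs with S-off-ℓ s∈S ¬ℓs
        ...   | here ≡.refl                 = ¬mA ms
        ...   | there (here ≡.refl)         = ¬mB ms
        ...   | there (there (here ≡.refl)) = ¬mC ms

    collinear-ABC : Point → ℕ
    collinear-ABC Y = ∑[ m ∈ pencil Y ] ([ m ∋ A ] * ([ m ∋ B ] * [ m ∋ C ]))

    zeroSecantsThrough-formula : ∀ {Y} → Y ∈ ℓ∖S →
      zeroSecantsThrough Y + (4 + collinear-ABC Y) ≡ size + 1 + (collinear A B Y + (collinear A C Y + collinear B C Y))
    zeroSecantsThrough-formula {Y} Y∈ℓ∖S = begin
      zeroSecantsThrough Y + (4 + collinear-ABC Y)
        ≡⟨ ≡.cong (zeroSecantsThrough Y +_)
             (≡.cong₂ _+_ (pencil-∋ {Y} ℓY) (≡.cong₂ _+_ (pencil-through (Y≢ (here ≡.refl)))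
               (≡.cong₂ _+_ (pencil-through (Y≢ (there (here ≡.refl))))
                 (≡.cong (_+ collinear-ABC Y) (pencil-through (Y≢ (there (there (here ≡.refl))))))))) ⟨
      zeroSecantsThrough Y + (∑[ m ∈ pencil Y ] χ (m ≟ₚ ℓ) + (∑[ m ∈ pencil Y ] [ m ∋ A ]
        + (∑[ m ∈ pencil Y ] [ m ∋ B ] + (∑[ m ∈ pencil Y ] [ m ∋ C ] + collinear-ABC Y))))
        ≡⟨ ∑-+-nested (pencil Y) _ _ (∑-+-nested (pencil Y) _ _ (∑-+-nested (pencil Y) _ _
             (∑-+-nested (pencil Y) _ _ (∑-+ (pencil Y) _ _)))) ⟨
      ∑[ m ∈ pencil Y ] (χ (meet S m ≟ 0) + (χ (m ≟ₚ ℓ)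
        + ([ m ∋ A ] + ([ m ∋ B ] + ([ m ∋ C ] + [ m ∋ A ] * ([ m ∋ B ] * [ m ∋ C ]))))))
        ≡⟨ ∑-cong-∈ (pencil Y) inclusion-exclusion ⟩
      ∑[ m ∈ pencil Y ] (1 + ([ m ∋ A ] * [ m ∋ B ] + ([ m ∋ A ] * [ m ∋ C ] + [ m ∋ B ] * [ m ∋ C ])))
        ≡⟨ ∑-+-nested (pencil Y) _ _ (∑-+-nested (pencil Y) _ _ (∑-+ (pencil Y) _ _)) ⟩
      ∑[ _ ∈ pencil Y ] 1 + (collinear A B Y + (collinear A C Y + collinear B C Y))
        ≡⟨ ≡.cong (_+ (collinear A B Y + (collinear A C Y + collinear B C Y)))
             (≡.trans (∑-const (pencil Y) 1) (≡.trans (*-identityʳ _) (length-pencil Y))) ⟩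
      size + 1 + (collinear A B Y + (collinear A C Y + collinear B C Y)) ∎
      where
      open ≡.≡-Reasoning
      onℓOffS : OnℓOffS Y
      onℓOffS = proj₂ (∈-filter⁻ onℓOffS? {xs = allPoints} Y∈ℓ∖S)
      ℓY = proj₁ onℓOffS
      Y≢ : ∀ {X} → X ∈ A ∷ B ∷ C ∷ [] → X ≢ Y
      Y≢ X∈ABC ≡.refl = proj₂ (off-ℓ X∈ABC) ℓY
      inclusion-exclusion : ∀ {m} → m ∈ pencil Y →
        χ (meet S m ≟ 0) + (χ (m ≟ₚ ℓ)
          + ([ m ∋ A ] + ([ m ∋ B ] + ([ m ∋ C ] + [ m ∋ A ] * ([ m ∋ B ] * [ m ∋ C ])))))
          ≡ 1 + ([ m ∋ A ] * [ m ∋ B ] + ([ m ∋ A ] * [ m ∋ C ] + [ m ∋ B ] * [ m ∋ C ]))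
      inclusion-exclusion {m} m∈pencil with m ≟ₚ ℓ
      ... | no m≢ℓ = inclusion-exclusion₃ (incident? m A) (incident? m B) (incident? m C) (meet S m ≟ 0)
                       (proj₁ ABC⇔) (proj₂ ABC⇔)
        where
        ABC⇔ = zero-secant⇔misses-ABC onℓOffS (proj₂ (∈-filter⁻ (λ m → incident? m Y) {xs = allPoints} m∈pencil)) m≢ℓ
      ... | yes ≡.refl = on-ℓ (meet S ℓ ≟ 0) (incident? ℓ A) (incident? ℓ B) (incident? ℓ C)
        where
        on-ℓ : (Z? : Dec (meet S ℓ ≡ 0)) (A? : Dec (Incident ℓ A)) (B? : Dec (Incident ℓ B)) (C? : Dec (Incident ℓ C)) →
          χ Z? + (1 + (χ A? + (χ B? + (χ C? + χ A? * (χ B? * χ C?)))))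
            ≡ 1 + (χ A? * χ B? + (χ A? * χ C? + χ B? * χ C?))
        on-ℓ (yes ℓ∩S≡0) _ _ _ = ⊥-elim (ℓ∩S≢0 ℓ∩S≡0)
        on-ℓ (no _) (yes ℓA) _ _ = ⊥-elim (proj₂ (off-ℓ (here ≡.refl)) ℓA)
        on-ℓ (no _) (no _) (yes ℓB) _ = ⊥-elim (proj₂ (off-ℓ (there (here ≡.refl))) ℓB)
        on-ℓ (no _) (no _) (no _) (yes ℓC) = ⊥-elim (proj₂ (off-ℓ (there (there (here ≡.refl)))) ℓC)
        on-ℓ (no _) (no _) (no _) (no _) = ≡.refl

    pairs : ℕ
    pairs = ∑ ℓ∖S (collinear A B) + (∑ ℓ∖S (collinear A C) + ∑ ℓ∖S (collinear B C))

    u₀-counts : u 0 S + (length ℓ∖S * 4 + ∑ ℓ∖S collinear-ABC) ≡ length ℓ∖S * (size + 1) + pairs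
    u₀-counts = begin
      u 0 S + (length ℓ∖S * 4 + ∑ ℓ∖S collinear-ABC)
        ≡⟨ ≡.cong₂ _+_ (u₀≡∑-zeroSecantsThrough ℓ∩S≢0)
                       (≡.cong (_+ ∑ ℓ∖S collinear-ABC) (≡.sym (∑-const ℓ∖S 4))) ⟩
      ∑ ℓ∖S zeroSecantsThrough + (∑[ _ ∈ ℓ∖S ] 4 + ∑ ℓ∖S collinear-ABC)
        ≡⟨ ∑-+-nested ℓ∖S _ _ (∑-+ ℓ∖S _ _) ⟨
      ∑[ Y ∈ ℓ∖S ] (zeroSecantsThrough Y + (4 + collinear-ABC Y))
        ≡⟨ ∑-cong-∈ ℓ∖S zeroSecantsThrough-formula ⟩
      ∑[ Y ∈ ℓ∖S ] (size + 1 + (collinear A B Y + (collinear A C Y + collinear B C Y)))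
        ≡⟨ ∑-+-nested ℓ∖S _ _ (∑-+-nested ℓ∖S _ _ (∑-+ ℓ∖S _ _)) ⟩
      ∑[ _ ∈ ℓ∖S ] (size + 1) + pairs
        ≡⟨ ≡.cong (_+ pairs) (∑-const ℓ∖S (size + 1)) ⟩
      length ℓ∖S * (size + 1) + pairs
        ∎
      where open ≡.≡-Reasoning

    length-ℓ∖S≡3 : length S ≡ size + 1 → length ℓ∖S ≡ 3
    length-ℓ∖S≡3 |S|≡q+1 = +-cancelʳ-≡ (meet S ℓ) _ _ (begin
      length ℓ∖S + meet S ℓ      ≡⟨ length-ℓ∖S ⟩
      size + 1                   ≡⟨ |S|≡q+1 ⟨
      length S                   ≡⟨ meet-+-∖ S ℓ ⟨
      meet S ℓ + length (S ∖ ℓ)  ≡⟨ ≡.cong (λ xs → meet S ℓ + length xs) S∖ℓ≡ABC ⟩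
      meet S ℓ + 3               ≡⟨ +-comm (meet S ℓ) 3 ⟩
      3 + meet S ℓ               ∎)
      where open ≡.≡-Reasoning

    u₀-range : length S ≡ size + 1 →
      (u 0 S + 9 ≡ 3 * size) ⊎ (u 0 S + 8 ≡ 3 * size) ⊎ (u 0 S + 7 ≡ 3 * size) ⊎ (u 0 S + 6 ≡ 3 * size)
    u₀-range |S|≡q+1 = range-from-counts {q = size}
      (∑-mono ℓ∖S ABC≤AB)
      (collinear-bound A≢B (proj₂ (off-ℓ (here ≡.refl))))
      (collinear-bound A≢C (proj₂ (off-ℓ (here ≡.refl))))
      (collinear-bound B≢C (proj₂ (off-ℓ (there (here ≡.refl)))))
      (≡.subst (λ w → u 0 S + (w * 4 + ∑ ℓ∖S collinear-ABC) ≡ w * (size + 1) + pairs)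
               (length-ℓ∖S≡3 |S|≡q+1) u₀-counts)
      where
      ABC≤AB : ∀ Y → collinear-ABC Y ≤ collinear A B Y
      ABC≤AB Y = ∑-mono (pencil Y) λ m →
        *-monoʳ-≤ [ m ∋ A ] (≤-trans (*-monoʳ-≤ [ m ∋ B ] (χ≤1 (incident? m C))) (≤-reflexive (*-identityʳ _)))

module Degree (F : FiniteField) where
  open FiniteField F using (size)
  open PG2 F
  open ProjectivePlane F using (line-through; allPoints-complete)
  open Incidences F using (meet-positive; _∖_; meet-+-∖)
  open Counting using (filter-nonempty)
  open import Data.Nat using (_+_; _∸_; _<_; _≟_)
  open import Data.Nat.Properties
    using (+-assoc; +-comm; +-cancelˡ-≡; m∸n+n≡m; <⇒≤; m∸n≢0⇒n<m; 0≢1+n; n>0⇒n≢0; n≢0⇒n>0)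
  open import Data.List.Membership.Propositional.Properties using (∈-filter⁺; ∈-length)

  u-meet≢0 : ∀ S m → u (meet S m) S ≢ 0
  u-meet≢0 S m = n>0⇒n≢0 (∈-length (∈-filter⁺ (λ m′ → meet S m′ ≟ meet S m) (allPoints-complete m) ≡.refl))

  degree-positive : ∀ {S d s} → s ∈ S → HasDegree S d → 0 < d
  degree-positive {S} {d} {s} s∈S (_ , vanishes-above) =
    n≢0⇒n>0 λ { ≡.refl → u-meet≢0 S m (vanishes-above (meet S m) (meet-positive m s∈S ms)) }
    where
    m = proj₁ (line-through s)
    ms = proj₂ (line-through s)

  secant-of-degree : ∀ {S d} → HasDegree S d → ∃ λ ℓ → meet S ℓ ≡ d
  secant-of-degree {S} {d} (u≢0 , _) = filter-nonempty (λ m → meet S m ≟ d) allPoints u≢0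

  secant-missing-three : ∀ {S} → length S ≡ size + 1 → HasDegree S (size ∸ 2) →
    ∃ λ ℓ → meet S ℓ ≢ 0 × length (S ∖ ℓ) ≡ 3
  secant-missing-three {S} |S|≡q+1 degree = ℓ , ℓ∩S≢0 , +-cancelˡ-≡ (meet S ℓ) _ _ (begin
    meet S ℓ + length (S ∖ ℓ)  ≡⟨ meet-+-∖ S ℓ ⟩
    length S                   ≡⟨ |S|≡q+1 ⟩
    q + 1                      ≡⟨ ≡.cong (_+ 1) (m∸n+n≡m (<⇒≤ 2<q)) ⟨
    q ∸ 2 + 2 + 1              ≡⟨ +-assoc (q ∸ 2) 2 1 ⟩
    q ∸ 2 + 3                  ≡⟨ ≡.cong (_+ 3) ℓ∩S≡q∸2 ⟨
    meet S ℓ + 3               ∎)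
    where
    open ≡.≡-Reasoning
    q = size
    S-nonempty : ∀ {xs : List Point} → length xs ≡ q + 1 → ∃ (_∈ xs)
    S-nonempty {[]}    |xs|≡q+1 = ⊥-elim (0≢1+n (≡.trans |xs|≡q+1 (+-comm q 1)))
    S-nonempty {x ∷ _} _        = x , here ≡.refl
    0<q∸2 : 0 < q ∸ 2
    0<q∸2 = degree-positive {S} (proj₂ (S-nonempty |S|≡q+1)) degree
    2<q : 2 < q
    2<q = m∸n≢0⇒n<m (n>0⇒n≢0 0<q∸2)
    ℓ = proj₁ (secant-of-degree {S} degree)
    ℓ∩S≡q∸2 = proj₂ (secant-of-degree {S} degree)
    ℓ∩S≢0 : meet S ℓ ≢ 0
    ℓ∩S≢0 = ≡.subst (_≢ 0) (≡.sym ℓ∩S≡q∸2) (n>0⇒n≢0 0<q∸2)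

open import Data.Nat using (_+_; _*_; _∸_)
open import Data.Sum using (_⊎_)
open FiniteField using (size)
open PG2 using (Point; u; HasDegree)

lemma4p18 : (F : FiniteField) → IsPrimePower (size F) →
    (S : List (Point F)) → Unique S → length S ≡ size F + 1 →
    HasDegree F S (size F ∸ 2) →
    (u F 0 S + 9 ≡ 3 * size F) ⊎ (u F 0 S + 8 ≡ 3 * size F)
      ⊎ (u F 0 S + 7 ≡ 3 * size F) ⊎ (u F 0 S + 6 ≡ 3 * size F)
lemma4p18 F _ S S! |S|≡q+1 degree = u₀-range |S|≡q+1
  where
  open Degree F using (secant-missing-three)
  three-elements : ∀ {A : Set} {xs : List A} → length xs ≡ 3 → ∃₂ λ a b → ∃ λ c → xs ≡ a ∷ b ∷ c ∷ []
  three-elements {xs = a ∷ b ∷ c ∷ []} _ = a , b , c , ≡.refl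
  secant = secant-missing-three {S} |S|≡q+1 degree
  open ZeroSecants F S S! (proj₁ secant)
  open ThreePointsOffℓ (proj₂ (proj₂ (proj₂ (three-elements (proj₂ (proj₂ secant)))))) (proj₁ (proj₂ secant))
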